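{- Let $m\in\mathbb{N}$ and $k\ge 0$. Then there are only finitely many $n\in\mathbb{N}$ with $\gcd(m,n)=1$ and $\Omega(n)=k$ such that $mn$ is a primitive abundant number.
   Context: $\Omega(n)$ is the number of prime factors of $n$ counted with multiplicity. For $n\in\mathbb{N}$, $\sigma(n)=\sum_{d\mid n}d$; $n$ is deficient if $\sigma(n)<2n$, abundant if $\sigma(n)>2n$, non-deficient if $\sigma(n)\ge 2n$. A primitive abundant number is an abundant number all of whose proper divisors are deficient. -}

module Defs where

open import Data.Nat.Base using (ℕ; zero; suc; _*_; _<_; _≤_; _+_)
open import Data.Nat.Divisibility using (_∣_; _∣?_)
open import Data.Nat.ListAction using (sum)
open import Data.List.Base using (List; filter; upTo; map; length)
open import Data.Nat.Primality.Factorisation using (factorise; factors)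
open import Data.Product.Base using (_×_)

divisors : ℕ → List ℕ
divisors n = filter (_∣? n) (map suc (upTo n))

σ : ℕ → ℕ
σ n = sum (divisors n)

Ω : ℕ → ℕ
Ω zero    = 0
Ω (suc k) = length (factors (factorise (suc k)))

Deficient : ℕ → Set
Deficient n = σ n < 2 * n

Abundant : ℕ → Set
Abundant n = 2 * n < σ n

PrimitiveAbundant : ℕ → Set
PrimitiveAbundant n =
  Abundant n × (∀ d → 1 ≤ d → d ∣ n → d < n → Deficient d)

{-# OPTIONS --safe #-}

-- Let p be the least prime factor of n and k = Ω(n). Since σ(q x) ≤ (q + 1) σ(x) for every
-- prime q and (q + 1)/q ≤ (p + 1)/p for every prime factor q of n, abundance of m n gives
-- 2 < σ(m n)/(m n) ≤ (σ(m)/m) (1 + 1/p)^k, while m, a proper divisor of m n, is deficient: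
-- σ(m) ≤ 2m − 1. Together with (p + 1)^k − p^k ≤ k (p + 1)^(k−1) this forces p + 1 < 2 m k.
-- As (m p) (n/p) = m n is primitive abundant and Ω(n/p) = k − 1, induction on k, uniformly
-- in m, bounds n/p by the bound for m p, and only finitely many p remain.

module Submission where

open import Defs
open import Data.List.Base using ([]; _∷_; _++_; map; upTo; length)
open import Data.List.Extrema.Nat using (max; xs≤max)
open import Data.List.Membership.Propositional using (_∈_)
open import Data.List.Membership.Propositional.Properties
  using (∈-∃++; ∈-++⁺ˡ; ∈-++⁺ʳ; ∈-map⁺; ∈-filter⁺; ∈-filter⁻; ∈-upTo⁺)
open import Data.List.Relation.Binary.Permutation.Propositional
  using (_↭_; prep; swap; ↭-refl; ↭-sym; ↭-trans)
open import Data.List.Relation.Binary.Permutation.Propositional.Properties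
  using (All-resp-↭; ∈-resp-↭; ↭-length; shift)
open import Data.List.Relation.Binary.Subset.Propositional using (_⊆_)
open import Data.List.Relation.Unary.All as All using (All; []; _∷_)
open import Data.List.Relation.Unary.AllPairs using (_∷_)
open import Data.List.Relation.Unary.Any using (here; there)
open import Data.List.Relation.Unary.Unique.Propositional using (Unique)
import Data.List.Relation.Unary.Unique.Propositional.Properties as Unique
open import Data.Nat.Base
open import Data.Nat.Divisibility using (_∣_; _∣?_; divides; ∣⇒≤; *-cancelˡ-∣; m∣m*n; 0∣⇒≡0)
open import Data.Nat.GCD using (gcd)
open import Data.Nat.ListAction using (sum; product)
open import Data.Nat.ListAction.Properties using (sum-++; sum-↭; product-↭)
open import Data.Nat.Primality
  using (Prime; euclidsLemma; prime⇒nonZero; prime⇒nonTrivial; productOfPrimes≥1)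
open import Data.Nat.Primality.Factorisation using (factorise; module PrimeFactorisation)
open import Data.Nat.Properties
open import Data.Nat.Solver using (module +-*-Solver)
open import Data.Product.Base using (∃-syntax; ∃₂; _×_; _,_; proj₂)
open import Data.Sum.Base using (_⊎_; inj₁; inj₂)
open import Relation.Binary.PropositionalEquality
  using (_≡_; refl; sym; trans; cong; subst; subst₂)
open import Relation.Nullary using (yes; no; contradiction)

import Algebra.Properties.CommutativeSemigroup *-commutativeSemigroup as *-Properties
open +-*-Solver using (solve; _:+_; _:*_; _:=_; con)

∈⇒↭∷ : ∀ {x : ℕ} {xs} → x ∈ xs → ∃[ ys ] xs ↭ x ∷ ys
∈⇒↭∷ x∈xs with ys , zs , refl ← ∈-∃++ x∈xs = ys ++ zs , shift _ ys zs

sum-mono-⊆ : ∀ {xs ys} → Unique xs → xs ⊆ ys → sum xs ≤ sum ys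
sum-mono-⊆ {[]}     _                 _     = z≤n
sum-mono-⊆ {x ∷ xs} {ys} (x∉xs ∷ uxs) xs⊆ys with ys′ , ys↭ ← ∈⇒↭∷ (xs⊆ys (here refl)) =
  begin
    x + sum xs   ≤⟨ +-monoʳ-≤ x (sum-mono-⊆ uxs xs⊆ys′) ⟩
    x + sum ys′  ≡⟨ sum-↭ ys↭ ⟨
    sum ys       ∎
  where
  open ≤-Reasoning
  xs⊆ys′ : xs ⊆ ys′
  xs⊆ys′ y∈xs with ∈-resp-↭ ys↭ (xs⊆ys (there y∈xs))
  ... | here y≡x    = contradiction (sym y≡x) (All.lookup x∉xs y∈xs)
  ... | there y∈ys′ = y∈ys′

sum-map-*ˡ : ∀ q xs → sum (map (q *_) xs) ≡ q * sum xs
sum-map-*ˡ q []       = sym (*-zeroʳ q)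
sum-map-*ˡ q (x ∷ xs) =
  trans (cong (q * x +_) (sum-map-*ˡ q xs)) (sym (*-distribˡ-+ q x (sum xs)))

divisors-unique : ∀ n → Unique (divisors n)
divisors-unique n = Unique.filter⁺ (_∣? n) (Unique.map⁺ suc-injective (Unique.upTo⁺ n))

∈-divisors⁺ : ∀ {d n} .{{_ : NonZero n}} → d ∣ n → d ∈ divisors n
∈-divisors⁺ {zero}  {n} 0∣n = contradiction (0∣⇒≡0 0∣n) (≢-nonZero⁻¹ n)
∈-divisors⁺ {suc d} {n} d∣n = ∈-filter⁺ (_∣? n) (∈-map⁺ suc (∈-upTo⁺ (∣⇒≤ d∣n))) d∣n

∈-divisors⁻ : ∀ {d n} → d ∈ divisors n → d ∣ n
∈-divisors⁻ {n = n} d∈ = proj₂ (∈-filter⁻ (_∣? n) {xs = map suc (upTo n)} d∈)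

∣q*n⇒∣n⊎≡q*∣n : ∀ {q n d} → Prime q → d ∣ q * n → d ∣ n ⊎ ∃[ c ] c ∣ n × d ≡ q * c
∣q*n⇒∣n⊎≡q*∣n {q} {n} {d} q-prime (divides e qn≡ed)
  with euclidsLemma e d q-prime (divides n (trans (sym qn≡ed) (*-comm q n)))
... | inj₁ (divides c refl) =
  inj₁ (*-cancelˡ-∣ q {{prime⇒nonZero q-prime}} (divides c (trans qn≡ed (*-assoc c q d))))
... | inj₂ (divides c refl) =
  inj₂ (c , *-cancelˡ-∣ q {{prime⇒nonZero q-prime}}
              (divides e (trans qn≡ed (cong (e *_) (*-comm c q))))
          , *-comm c q)

σ[q*n]≤[1+q]*σ[n] : ∀ {q} n → Prime q → σ (q * n) ≤ suc q * σ n
σ[q*n]≤[1+q]*σ[n] {q} zero      _       rewrite *-zeroʳ q = z≤n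
σ[q*n]≤[1+q]*σ[n] {q} n@(suc _) q-prime = begin
  σ (q * n)                                    ≤⟨ sum-mono-⊆ (divisors-unique (q * n)) divisors⊆ ⟩
  sum (divisors n ++ map (q *_) (divisors n))  ≡⟨ sum-++ (divisors n) _ ⟩
  σ n + sum (map (q *_) (divisors n))          ≡⟨ cong (σ n +_) (sum-map-*ˡ q (divisors n)) ⟩
  suc q * σ n                                  ∎
  where
  open ≤-Reasoning
  divisors⊆ : divisors (q * n) ⊆ divisors n ++ map (q *_) (divisors n)
  divisors⊆ d∈ with ∣q*n⇒∣n⊎≡q*∣n q-prime (∈-divisors⁻ d∈)
  ... | inj₁ d∣n             = ∈-++⁺ˡ (∈-divisors⁺ d∣n)
  ... | inj₂ (c , c∣n , refl) = ∈-++⁺ʳ (divisors n) (∈-map⁺ (q *_) (∈-divisors⁺ c∣n))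

σ[m*P]*p^k≤σ[m]*P*[1+p]^k : ∀ m {p} ps → All Prime ps → All (p ≤_) ps →
  σ (m * product ps) * p ^ length ps ≤ σ m * product ps * suc p ^ length ps
σ[m*P]*p^k≤σ[m]*P*[1+p]^k m [] [] []
  rewrite *-identityʳ m | *-identityʳ (σ m) | *-identityʳ (σ m) = ≤-refl
σ[m*P]*p^k≤σ[m]*P*[1+p]^k m {p} (q ∷ qs) (q-prime ∷ primes) (p≤q ∷ p≤qs) = begin
  σ (m * (q * P)) * (p * p ^ k)  ≡⟨ cong (λ x → σ x * (p * p ^ k)) (*-Properties.x∙yz≈y∙xz m q P) ⟩
  σ (q * (m * P)) * (p * p ^ k)  ≤⟨ *-monoˡ-≤ (p * p ^ k) (σ[q*n]≤[1+q]*σ[n] (m * P) q-prime) ⟩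
  (suc q * S) * (p * p ^ k)      ≡⟨ regroup S q p (p ^ k) ⟩
  (suc q * p) * (S * p ^ k)      ≤⟨ *-monoʳ-≤ (suc q * p) (σ[m*P]*p^k≤σ[m]*P*[1+p]^k m qs primes p≤qs) ⟩
  (suc q * p) * R                ≤⟨ *-monoˡ-≤ R [1+q]*p≤q*[1+p] ⟩
  (q * suc p) * R                ≡⟨ rearrange q p (σ m) P (suc p ^ k) ⟩
  σ m * (q * P) * (suc p * suc p ^ k) ∎
  where
  open ≤-Reasoning
  P = product qs
  k = length qs
  S = σ (m * P)
  R = σ m * P * suc p ^ k
  [1+q]*p≤q*[1+p] : suc q * p ≤ q * suc p
  [1+q]*p≤q*[1+p] = subst (suc q * p ≤_) (sym (*-suc q p)) (+-monoˡ-≤ (q * p) p≤q)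
  regroup : ∀ s q p r → suc q * s * (p * r) ≡ suc q * p * (s * r)
  regroup = solve 4 (λ s q p r →
    ((con 1 :+ q) :* s) :* (p :* r) := ((con 1 :+ q) :* p) :* (s :* r)) refl
  rearrange : ∀ q p a b c → q * suc p * (a * b * c) ≡ a * (q * b) * (suc p * c)
  rearrange = solve 5 (λ q p a b c →
    (q :* (con 1 :+ p)) :* (a :* b :* c) := a :* (q :* b) :* ((con 1 :+ p) :* c)) refl

[1+p]^[1+j]≤p^[1+j]+[1+j]*[1+p]^j : ∀ p j → suc p ^ suc j ≤ p ^ suc j + suc j * suc p ^ j
[1+p]^[1+j]≤p^[1+j]+[1+j]*[1+p]^j p zero    rewrite *-identityʳ p = ≤-reflexive (+-comm 1 p)
[1+p]^[1+j]≤p^[1+j]+[1+j]*[1+p]^j p (suc j) = begin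
  suc p * suc p ^ suc j                                ≤⟨ *-monoʳ-≤ (suc p) ([1+p]^[1+j]≤p^[1+j]+[1+j]*[1+p]^j p j) ⟩
  suc p * (p ^ suc j + suc j * A)                      ≡⟨ expand p (p ^ suc j) j A ⟩
  p * p ^ suc j + (p ^ suc j + suc j * (suc p * A))    ≤⟨ +-monoʳ-≤ (p * p ^ suc j) (+-monoˡ-≤ _ (^-monoˡ-≤ (suc j) (n≤1+n p))) ⟩
  p * p ^ suc j + (suc p ^ suc j + suc j * (suc p * A)) ∎
  where
  open ≤-Reasoning
  A = suc p ^ j
  expand : ∀ p a j b → suc p * (a + suc j * b) ≡ p * a + (a + suc j * (suc p * b))
  expand = solve 4 (λ p a j b → (con 1 :+ p) :* (a :+ (con 1 :+ j) :* b)
                               := p :* a :+ (a :+ (con 1 :+ j) :* ((con 1 :+ p) :* b))) refl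

1+p<a*[1+j] : ∀ {a s} p j → s < a → a * p ^ suc j < s * suc p ^ suc j → suc p < a * suc j
1+p<a*[1+j] {a} {s} p j s<a a*p^k<s*[1+p]^k =
  *-cancelʳ-< A (suc p) (a * suc j)
    (subst (X <_) (sym (*-assoc a (suc j) A))
      (+-cancelˡ-< (s * X) X (a * (suc j * A))
        (subst (_< s * X + a * (suc j * A)) (+-comm X (s * X)) X+s*X<s*X+a*[1+j]*A)))
  where
  A = suc p ^ j
  X = suc p ^ suc j
  X+s*X<s*X+a*[1+j]*A : X + s * X < s * X + a * (suc j * A)
  X+s*X<s*X+a*[1+j]*A = begin-strict
    X + s * X                          ≤⟨ *-monoˡ-≤ X s<a ⟩
    a * X                              ≤⟨ *-monoʳ-≤ a ([1+p]^[1+j]≤p^[1+j]+[1+j]*[1+p]^j p j) ⟩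
    a * (p ^ suc j + suc j * A)        ≡⟨ *-distribˡ-+ a (p ^ suc j) (suc j * A) ⟩
    a * p ^ suc j + a * (suc j * A)    <⟨ +-monoˡ-< (a * (suc j * A)) a*p^k<s*[1+p]^k ⟩
    s * X + a * (suc j * A)            ∎
    where open ≤-Reasoning

primitiveAbundant⇒deficient : ∀ m {n} → 1 < n → PrimitiveAbundant (m * n) → Deficient m
primitiveAbundant⇒deficient zero      _   (() , _)
primitiveAbundant⇒deficient m@(suc _) {n} 1<n (_ , properDivisorsDeficient) =
  properDivisorsDeficient m (s≤s z≤n) (m∣m*n n) (m<m*n m n 1<n)

1+p<2*m*[1+Ω] : ∀ m {p} rest → Prime p → All Prime rest → All (p ≤_) rest →
  PrimitiveAbundant (m * (p * product rest)) → suc p < 2 * m * suc (length rest)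
1+p<2*m*[1+Ω] m {p} rest p-prime primes p≤rest pa@(abundant , _) =
  1+p<a*[1+j] p (length rest) σm<2m
    (*-cancelʳ-< n (2 * m * p ^ k) (σ m * suc p ^ k)
      (subst₂ _<_ (swap₁ m n (p ^ k)) (swap₂ (σ m) n (suc p ^ k)) 2*m*n*p^k<σm*n*[1+p]^k))
  where
  n = p * product rest
  k = suc (length rest)
  1<n : 1 < n
  1<n = *-mono-≤ (nonTrivial⇒n>1 p {{prime⇒nonTrivial p-prime}}) (productOfPrimes≥1 primes)
  σm<2m : σ m < 2 * m
  σm<2m = primitiveAbundant⇒deficient m 1<n pa
  2*m*n*p^k<σm*n*[1+p]^k : 2 * (m * n) * p ^ k < σ m * n * suc p ^ k
  2*m*n*p^k<σm*n*[1+p]^k =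
    <-≤-trans (*-monoˡ-< (p ^ k) {{m^n≢0 p k {{prime⇒nonZero p-prime}}}} abundant)
              (σ[m*P]*p^k≤σ[m]*P*[1+p]^k m (p ∷ rest) (p-prime ∷ primes) (≤-refl ∷ p≤rest))
  swap₁ : ∀ m n r → 2 * (m * n) * r ≡ 2 * m * r * n
  swap₁ = solve 3 (λ m n r → con 2 :* (m :* n) :* r := con 2 :* m :* r :* n) refl
  swap₂ : ∀ s n r → s * n * r ≡ s * r * n
  swap₂ = solve 3 (λ s n r → s :* n :* r := s :* r :* n) refl

↭-minimum∷ : ∀ (q : ℕ) qs → ∃₂ λ p rest → q ∷ qs ↭ p ∷ rest × All (p ≤_) rest
↭-minimum∷ q [] = q , [] , ↭-refl , []
↭-minimum∷ q (r ∷ rs) with p , rest , r∷rs↭ , p≤rest ← ↭-minimum∷ r rs with q ≤? p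
... | yes q≤p = q , r ∷ rs , ↭-refl , All-resp-↭ (↭-sym r∷rs↭) (q≤p ∷ All.map (≤-trans q≤p) p≤rest)
... | no  q≰p = p , q ∷ rest , ↭-trans (prep q r∷rs↭) (swap q p ↭-refl) , ≰⇒≥ q≰p ∷ p≤rest

-- The candidates p for the least prime factor are those with p + 1 < 2 m (j + 1).
primitiveAbundantBound : ℕ → ℕ → ℕ
primitiveAbundantBound zero    m = 1
primitiveAbundantBound (suc j) m =
  max 0 (map (λ p → p * primitiveAbundantBound j (m * p)) (upTo (2 * m * suc j)))

product≤primitiveAbundantBound : ∀ j m ps → All Prime ps → length ps ≡ j →
  PrimitiveAbundant (m * product ps) → product ps ≤ primitiveAbundantBound j m
product≤primitiveAbundantBound zero    m []       _      _   _  = ≤-refl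
product≤primitiveAbundantBound (suc j) m (q ∷ qs) primes len pa
  with p , rest , qs↭ , p≤rest ← ↭-minimum∷ q qs = begin
    product (q ∷ qs)  ≡⟨ product-↭ qs↭ ⟩
    p * product rest  ≤⟨ *-monoʳ-≤ p (product≤primitiveAbundantBound j (m * p) rest primes-rest len-rest pa-mp) ⟩
    candidate p       ≤⟨ All.lookup (xs≤max 0 _) (∈-map⁺ candidate (∈-upTo⁺ p<2*m*[1+j])) ⟩
    primitiveAbundantBound (suc j) m ∎
  where
  open ≤-Reasoning
  candidate : ℕ → ℕ
  candidate p = p * primitiveAbundantBound j (m * p)
  primes-p∷rest : All Prime (p ∷ rest)
  primes-p∷rest = All-resp-↭ qs↭ primes
  p-prime : Prime p
  p-prime = All.head primes-p∷rest
  primes-rest : All Prime rest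
  primes-rest = All.tail primes-p∷rest
  len-rest : length rest ≡ j
  len-rest = suc-injective (trans (sym (↭-length qs↭)) len)
  pa-p*rest : PrimitiveAbundant (m * (p * product rest))
  pa-p*rest = subst (λ n → PrimitiveAbundant (m * n)) (product-↭ qs↭) pa
  pa-mp : PrimitiveAbundant (m * p * product rest)
  pa-mp = subst PrimitiveAbundant (sym (*-assoc m p (product rest))) pa-p*rest
  p<2*m*[1+j] : p < 2 * m * suc j
  p<2*m*[1+j] = <-trans (n<1+n p)
    (subst (λ l → suc p < 2 * m * suc l) len-rest
      (1+p<2*m*[1+Ω] m rest p-prime primes-rest p≤rest pa-p*rest))

lemma3p1 : ∀ (m k : ℕ) → ∃[ B ] (∀ (n : ℕ) → gcd m n ≡ 1 → Ω n ≡ k →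
               PrimitiveAbundant (m * n) → n ≤ B)
lemma3p1 m k = primitiveAbundantBound k m , bounded
  where
  bounded : ∀ n → gcd m n ≡ 1 → Ω n ≡ k → PrimitiveAbundant (m * n) →
            n ≤ primitiveAbundantBound k m
  bounded zero      _ _    (abundant , _) = contradiction (subst Abundant (*-zeroʳ m) abundant) λ ()
  bounded n@(suc _) _ Ωn≡k pa =
    subst (_≤ primitiveAbundantBound k m) (sym isFactorisation)
      (product≤primitiveAbundantBound k m factors factorsPrime Ωn≡k
        (subst (λ x → PrimitiveAbundant (m * x)) isFactorisation pa))
    where open PrimeFactorisation (factorise n)
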